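{- Let $p$ be a prime, $n\ge1$, let $k,\ell\ge0$ and let $F\in R_k$. Then for any $\psi_1,\dots,\psi_n\in R_\ell$ we have $F(\psi_1,\dots,\psi_n)\in R_{k+\ell}$.
   Context: For $k\ge0$, $R_k$ denotes the subring $R_k=\mathbb{Z}[X_1^{p^k},\dots,X_n^{p^k}]+p\,\mathbb{Z}[X_1^{p^{k-1}},\dots,X_n^{p^{k-1}}]+\dots+p^k\mathbb{Z}[X_1,\dots,X_n]$ of $\mathbb{Z}[X_1,\dots,X_n]$. -}

module Defs where

open import Data.Nat using (ℕ; zero; suc)
open import Data.Integer using (ℤ; +_; -[1+_]) renaming (_+_ to _+ℤ_; _*_ to _*ℤ_)
open import Data.Fin using (Fin; zero; suc; toℕ)

data Poly (n : ℕ) : Set where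
  con  : ℤ → Poly n
  var  : Fin n → Poly n
  _⊕_  : Poly n → Poly n → Poly n
  _⊛_  : Poly n → Poly n → Poly n

infixl 6 _⊕_
infixl 7 _⊛_
infix 4 _≈_

-- Poly n / ≈ is the free commutative Z-algebra
-- on n generators, i.e. the polynomial ring Z[X_1,...,X_n].
data _≈_ {n : ℕ} : Poly n → Poly n → Set where
  ≈-refl  : ∀ {a} → a ≈ a
  ≈-sym   : ∀ {a b} → a ≈ b → b ≈ a
  ≈-trans : ∀ {a b c} → a ≈ b → b ≈ c → a ≈ c
  ⊕-cong  : ∀ {a b c d} → a ≈ b → c ≈ d → a ⊕ c ≈ b ⊕ d
  ⊛-cong  : ∀ {a b c d} → a ≈ b → c ≈ d → a ⊛ c ≈ b ⊛ d
  ⊕-assoc : ∀ a b c → (a ⊕ b) ⊕ c ≈ a ⊕ (b ⊕ c)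
  ⊕-comm  : ∀ a b → a ⊕ b ≈ b ⊕ a
  ⊕-idˡ   : ∀ a → con (+ 0) ⊕ a ≈ a
  ⊕-invˡ  : ∀ a → (con -[1+ 0 ] ⊛ a) ⊕ a ≈ con (+ 0)
  ⊛-assoc : ∀ a b c → (a ⊛ b) ⊛ c ≈ a ⊛ (b ⊛ c)
  ⊛-comm  : ∀ a b → a ⊛ b ≈ b ⊛ a
  ⊛-idˡ   : ∀ a → con (+ 1) ⊛ a ≈ a
  distribˡ : ∀ a b c → a ⊛ (b ⊕ c) ≈ (a ⊛ b) ⊕ (a ⊛ c)
  con-+   : ∀ x y → con (x +ℤ y) ≈ con x ⊕ con y
  con-*   : ∀ x y → con (x *ℤ y) ≈ con x ⊛ con y

_^P_ : ∀ {n} → Poly n → ℕ → Poly n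
a ^P zero  = con (+ 1)
a ^P suc e = a ⊛ (a ^P e)

subst : ∀ {n m} → Poly n → (Fin n → Poly m) → Poly m
subst (con c) ψ = con c
subst (var i) ψ = ψ i
subst (a ⊕ b) ψ = subst a ψ ⊕ subst b ψ
subst (a ⊛ b) ψ = subst a ψ ⊛ subst b ψ

sumFin : ∀ {n} (m : ℕ) → (Fin m → Poly n) → Poly n
sumFin zero    f = con (+ 0)
sumFin (suc m) f = f zero ⊕ sumFin m (λ j → f (suc j))

open import Data.Nat using (_∸_; _^_)
open import Data.Product using (Σ)

-- R_k = Z[X^{p^k}] + p Z[X^{p^{k-1}}] + ... + p^k Z[X]:
-- F ∈ R_k iff F = Σ_{j=0}^{k} p^j G_j(X_1^{p^{k-j}},...,X_n^{p^{k-j}}) for some G_j.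
inR : (p k : ℕ) {n : ℕ} → Poly n → Set
inR p k {n} F =
  Σ (Fin (suc k) → Poly n) λ G →
    F ≈ sumFin (suc k) (λ j →
          con (+ (p ^ toℕ j)) ⊛ subst (G j) (λ i → var i ^P (p ^ (k ∸ toℕ j))))

-- We work with a recursive description of R_k: R_0 = Z[X], and
-- R_{k+1} = { σ_{p^{k+1}}(G) + p·H : G ∈ Z[X], H ∈ R_k },
-- where σ_e is the substitution X_i ↦ X_i^e (module Levels, which also shows
-- that this agrees with the explicit sum Σ_j p^j G_j(X^{p^{k-j}}) of inR).
-- The proof rests on four facts:
--   * Z[X] is a commutative ring; each R_k is a subring containing σ_{p^k}(Z[X]),
--     and p·R_k ⊆ R_{k+1};
--   * Frobenius: G^p ≡ σ_p(G) (mod p), from the freshman's dream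
--     (a + b)^p ≡ a^p + b^p and Fermat's little theorem for integer constants;
--   * hence x ∈ R_k implies x^p ∈ R_{k+1}, using the second-order binomial
--     expansion (A + pH)^p = A^p + p·A^{p-1}·pH + (pH)^2·T;
--   * iterating, ψ ∈ R_ℓ gives ψ^{p^d} ∈ R_{d+ℓ}, and p^j·R_m ⊆ R_{j+m}.
-- The theorem follows termwise: F(ψ) = Σ_j p^j G_j(ψ^{p^{k-j}}) with
-- G_j(ψ^{p^{k-j}}) ∈ R_{(k-j)+ℓ}, so every term lies in R_{k+ℓ}.
module Submission where

open import Defs
open import Data.Nat using (ℕ; _+_; _≤_)
open import Data.Nat.Primality using (Prime)
open import Data.Fin using (Fin)

open import Level using (0ℓ)
open import Data.Nat using (zero; suc; _<_; z≤n; s≤s; _∸_; _*_; _^_; _!)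
import Data.Nat.Properties as ℕP
open import Data.Nat.Divisibility using (_∣_; _∤_; divides; ∣1⇒≡1; ∣⇒≤; m∣m*n)
open import Data.Nat.DivMod using (m/n*n≡m)
open import Data.Nat.Primality using (euclidsLemma; prime⇒nonTrivial)
open import Data.Nat.Combinatorics using (_C_; nCn≡1; nCk≡n!/k![n-k]!; k![n∸k]!∣n!)
open import Data.Nat.Properties using (_!*_!≢0)
open import Data.Integer using (ℤ; +_; -[1+_])
import Data.Integer.Properties as ℤP
open import Data.Fin using (zero; suc; toℕ; inject₁; fromℕ)
import Data.Fin.Properties as FinP
open import Data.Product using (Σ; _×_; _,_; proj₁; proj₂)
open import Data.Sum using (inj₁; inj₂)
open import Data.Unit using (⊤; tt)
open import Data.Empty using (⊥-elim)
open import Data.Maybe using (Maybe; nothing; just)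
open import Relation.Nullary using (yes; no)
open import Relation.Binary.Bundles using (Setoid)
open import Relation.Binary.PropositionalEquality
  using (_≡_; refl; cong; cong₂; sym; trans; subst₂) renaming (subst to ≡-subst)
open import Algebra.Bundles using (CommutativeRing)
open import Algebra.Structures using (IsCommutativeRing)
open import Algebra.Solver.Ring.AlmostCommutativeRing
  using (AlmostCommutativeRing; fromCommutativeRing; _-Raw-AlmostCommutative⟶_)

prime∤! : ∀ {p} → Prime p → ∀ j → j < p → p ∤ j !
prime∤! pr zero j<p p∣1 with ∣1⇒≡1 p∣1
... | refl with prime⇒nonTrivial pr
... | ()
prime∤! pr (suc j) j<p p∣j! with euclidsLemma (suc j) (j !) pr p∣j!
... | inj₁ p∣1+j = ℕP.<⇒≱ j<p (∣⇒≤ p∣1+j)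
... | inj₂ p∣j!′ = prime∤! pr j (ℕP.<-trans (ℕP.n<1+n j) j<p) p∣j!′

-- The inner binomial coefficients C(p,k), 0 < k < p, are divisible by p:
-- p divides p! = C(p,k)·k!·(p-k)! but neither k! nor (p-k)!.
prime∣C : ∀ {p} → Prime p → ∀ k → 0 < k → k < p → p ∣ p C k
prime∣C {suc q} pr k 0<k k<p
  with euclidsLemma (suc q C k) (k ! * (suc q ∸ k) !) pr p∣product
  where
    instance _ = k !* (suc q ∸ k) !≢0
    factorial : (suc q C k) * (k ! * (suc q ∸ k) !) ≡ suc q !
    factorial = trans (cong (_* (k ! * (suc q ∸ k) !)) (nCk≡n!/k![n-k]! (ℕP.<⇒≤ k<p)))
                      (m/n*n≡m (k![n∸k]!∣n! (ℕP.<⇒≤ k<p)))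
    p∣product : suc q ∣ (suc q C k) * (k ! * (suc q ∸ k) !)
    p∣product = ≡-subst (suc q ∣_) (sym factorial) (m∣m*n (q !))
... | inj₁ p∣C = p∣C
... | inj₂ p∣k!·[p-k]! with euclidsLemma (k !) ((suc q ∸ k) !) pr p∣k!·[p-k]!
...   | inj₁ p∣k! = ⊥-elim (prime∤! pr k k<p p∣k!)
...   | inj₂ p∣[p-k]! =
        ⊥-elim (prime∤! pr (suc q ∸ k) (ℕP.∸-monoʳ-< {suc q} {k} {0} 0<k (ℕP.<⇒≤ k<p)) p∣[p-k]!)

subst-resp : ∀ {n m} {a b : Poly n} (φ : Fin n → Poly m) → a ≈ b → subst a φ ≈ subst b φ
subst-resp φ ≈-refl = ≈-refl
subst-resp φ (≈-sym e) = ≈-sym (subst-resp φ e)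
subst-resp φ (≈-trans e e′) = ≈-trans (subst-resp φ e) (subst-resp φ e′)
subst-resp φ (⊕-cong e e′) = ⊕-cong (subst-resp φ e) (subst-resp φ e′)
subst-resp φ (⊛-cong e e′) = ⊛-cong (subst-resp φ e) (subst-resp φ e′)
subst-resp φ (⊕-assoc a b c) = ⊕-assoc _ _ _
subst-resp φ (⊕-comm a b) = ⊕-comm _ _
subst-resp φ (⊕-idˡ a) = ⊕-idˡ _
subst-resp φ (⊕-invˡ a) = ⊕-invˡ _
subst-resp φ (⊛-assoc a b c) = ⊛-assoc _ _ _
subst-resp φ (⊛-comm a b) = ⊛-comm _ _
subst-resp φ (⊛-idˡ a) = ⊛-idˡ _
subst-resp φ (distribˡ a b c) = distribˡ _ _ _
subst-resp φ (con-+ x y) = con-+ x y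
subst-resp φ (con-* x y) = con-* x y

subst-cong : ∀ {n m} (G : Poly n) {φ ψ : Fin n → Poly m} → (∀ i → φ i ≈ ψ i) → subst G φ ≈ subst G ψ
subst-cong (con c) e = ≈-refl
subst-cong (var i) e = e i
subst-cong (a ⊕ b) e = ⊕-cong (subst-cong a e) (subst-cong b e)
subst-cong (a ⊛ b) e = ⊛-cong (subst-cong a e) (subst-cong b e)

subst-subst : ∀ {n m l} (G : Poly n) (φ : Fin n → Poly m) (ψ : Fin m → Poly l) →
              subst (subst G φ) ψ ≡ subst G (λ i → subst (φ i) ψ)
subst-subst (con c) φ ψ = refl
subst-subst (var i) φ ψ = refl
subst-subst (a ⊕ b) φ ψ = cong₂ _⊕_ (subst-subst a φ ψ) (subst-subst b φ ψ)
subst-subst (a ⊛ b) φ ψ = cong₂ _⊛_ (subst-subst a φ ψ) (subst-subst b φ ψ)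

subst-var : ∀ {n} (G : Poly n) → subst G var ≡ G
subst-var (con c) = refl
subst-var (var i) = refl
subst-var (a ⊕ b) = cong₂ _⊕_ (subst-var a) (subst-var b)
subst-var (a ⊛ b) = cong₂ _⊛_ (subst-var a) (subst-var b)

subst-^P : ∀ {n m} (a : Poly n) (φ : Fin n → Poly m) e → subst (a ^P e) φ ≡ subst a φ ^P e
subst-^P a φ zero = refl
subst-^P a φ (suc e) = cong (subst a φ ⊛_) (subst-^P a φ e)

subst-sumFin : ∀ {n m} k (f : Fin k → Poly n) (φ : Fin n → Poly m) →
               subst (sumFin k f) φ ≡ sumFin k (λ j → subst (f j) φ)
subst-sumFin zero f φ = refl
subst-sumFin (suc k) f φ = cong (subst (f zero) φ ⊕_) (subst-sumFin k (λ j → f (suc j)) φ)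

σ : ∀ {n} → ℕ → Poly n → Poly n
σ e G = subst G (λ i → var i ^P e)

≡⇒≈ : ∀ {n} {a b : Poly n} → a ≡ b → a ≈ b
≡⇒≈ refl = ≈-refl

module PolyRing (n : ℕ) where

  neg : Poly n → Poly n
  neg a = con -[1+ 0 ] ⊛ a

  isCommutativeRing : IsCommutativeRing (_≈_ {n}) _⊕_ _⊛_ neg (con (+ 0)) (con (+ 1))
  isCommutativeRing = record
    { isRing = record
      { +-isAbelianGroup = record
        { isGroup = record
          { isMonoid = record
            { isSemigroup = record
              { isMagma = record
                { isEquivalence = record { refl = ≈-refl ; sym = ≈-sym ; trans = ≈-trans }
                ; ∙-cong = ⊕-cong }
              ; assoc = ⊕-assoc }
            ; identity = ⊕-idˡ , λ a → ≈-trans (⊕-comm a _) (⊕-idˡ a) }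
          ; inverse = ⊕-invˡ , λ a → ≈-trans (⊕-comm a _) (⊕-invˡ a)
          ; ⁻¹-cong = ⊛-cong ≈-refl }
        ; comm = ⊕-comm }
      ; *-cong = ⊛-cong
      ; *-assoc = ⊛-assoc
      ; *-identity = ⊛-idˡ , λ a → ≈-trans (⊛-comm a _) (⊛-idˡ a)
      ; distrib = distribˡ , distribʳ }
    ; *-comm = ⊛-comm }
    where
      distribʳ : ∀ (a b c : Poly n) → (b ⊕ c) ⊛ a ≈ (b ⊛ a) ⊕ (c ⊛ a)
      distribʳ a b c = ≈-trans (⊛-comm _ a)
        (≈-trans (distribˡ a b c) (⊕-cong (⊛-comm a b) (⊛-comm a c)))

  commutativeRing : CommutativeRing 0ℓ 0ℓ
  commutativeRing = record { isCommutativeRing = isCommutativeRing }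

  open CommutativeRing commutativeRing public using (setoid; semiring; commutativeSemiring)

  private
    almostCommutativeRing : AlmostCommutativeRing 0ℓ 0ℓ
    almostCommutativeRing = fromCommutativeRing commutativeRing

    con-homomorphism : CommutativeRing.rawRing ℤP.+-*-commutativeRing
                         -Raw-AlmostCommutative⟶ almostCommutativeRing
    con-homomorphism = record
      { ⟦_⟧ = con
      ; +-homo = con-+
      ; *-homo = con-*
      ; -‿homo = λ x → ≈-trans (≡⇒≈ (cong con (sym (ℤP.-1*i≡-i x)))) (con-* _ x)
      ; 0-homo = ≈-refl
      ; 1-homo = ≈-refl }

    con-equal? : ∀ (x y : ℤ) → Maybe (con {n} x ≈ con y)
    con-equal? x y with x ℤP.≟ y
    ... | yes refl = just ≈-refl
    ... | no _ = nothing

  open import Algebra.Solver.Ring (CommutativeRing.rawRing ℤP.+-*-commutativeRing)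
    almostCommutativeRing con-homomorphism con-equal? public

  open import Algebra.Properties.Semiring.Exp semiring using (^-congˡ; ^-assocʳ)
  open import Algebra.Properties.Semiring.Exp semiring public using () renaming (_^_ to _^ᴿ_)
  open import Algebra.Properties.CommutativeSemiring.Exp commutativeSemiring using (^-distrib-*)

  ^≡^P : ∀ (a : Poly n) e → a ^ᴿ e ≡ a ^P e
  ^≡^P a zero = refl
  ^≡^P a (suc e) = cong (a ⊛_) (^≡^P a e)

  ^P-cong : ∀ {a b : Poly n} e → a ≈ b → a ^P e ≈ b ^P e
  ^P-cong {a} {b} e a≈b = subst₂ _≈_ (^≡^P a e) (^≡^P b e) (^-congˡ e a≈b)

  ^P-^P : ∀ (a : Poly n) x y → (a ^P x) ^P y ≈ a ^P (y * x)
  ^P-^P a x y = subst₂ _≈_ (trans (cong (_^ᴿ y) (^≡^P a x)) (^≡^P (a ^P x) y))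
                          (trans (cong (a ^ᴿ_) (ℕP.*-comm x y)) (^≡^P a (y * x)))
                          (^-assocʳ a x y)

  ^P-distrib : ∀ (a b : Poly n) e → (a ⊛ b) ^P e ≈ (a ^P e) ⊛ (b ^P e)
  ^P-distrib a b e = subst₂ _≈_ (^≡^P (a ⊛ b) e) (cong₂ _⊛_ (^≡^P a e) (^≡^P b e))
                              (^-distrib-* a b e)

  ^P-one : ∀ (a : Poly n) → a ^P 1 ≈ a
  ^P-one a = solve 1 (λ a → a :* con (+ 1) := a) ≈-refl a

  con-ℕ* : ∀ a b → con {n} (+ (a * b)) ≈ con (+ a) ⊛ con (+ b)
  con-ℕ* a b = ≈-trans (≡⇒≈ (cong con (ℤP.pos-* a b))) (con-* (+ a) (+ b))

  σ-σ : ∀ a b (G : Poly n) → σ a (σ b G) ≈ σ (b * a) G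
  σ-σ a b G = ≈-trans (≡⇒≈ (subst-subst G _ _)) (subst-cong G λ i →
    ≈-trans (≡⇒≈ (subst-^P (var i) _ b)) (^P-^P (var i) a b))

  σ-one : ∀ (G : Poly n) → σ 1 G ≈ G
  σ-one G = ≈-trans (subst-cong G (λ i → ^P-one (var i))) (≡⇒≈ (subst-var G))

  subst-σ : ∀ e (G : Poly n) (ψ : Fin n → Poly n) → subst (σ e G) ψ ≈ subst G (λ i → ψ i ^P e)
  subst-σ e G ψ = ≈-trans (≡⇒≈ (subst-subst G _ ψ)) (subst-cong G (λ i → ≡⇒≈ (subst-^P (var i) ψ e)))

  record IsSubring (S : Poly n → Set) : Set where
    field
      ∈-resp : ∀ {a b} → a ≈ b → S a → S b
      con∈   : ∀ c → S (con c)
      ⊕∈     : ∀ {a b} → S a → S b → S (a ⊕ b)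
      ⊛∈     : ∀ {a b} → S a → S b → S (a ⊛ b)

    ^P∈ : ∀ {a} e → S a → S (a ^P e)
    ^P∈ zero a∈ = con∈ (+ 1)
    ^P∈ (suc e) a∈ = ⊛∈ a∈ (^P∈ e a∈)

    subst∈ : ∀ {ψ : Fin n → Poly n} → (∀ i → S (ψ i)) → ∀ G → S (subst G ψ)
    subst∈ ψ∈ (con c) = con∈ c
    subst∈ ψ∈ (var i) = ψ∈ i
    subst∈ ψ∈ (a ⊕ b) = ⊕∈ (subst∈ ψ∈ a) (subst∈ ψ∈ b)
    subst∈ ψ∈ (a ⊛ b) = ⊛∈ (subst∈ ψ∈ a) (subst∈ ψ∈ b)

    sumFin∈ : ∀ k {f : Fin k → Poly n} → (∀ j → S (f j)) → S (sumFin k f)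
    sumFin∈ zero f∈ = con∈ (+ 0)
    sumFin∈ (suc k) f∈ = ⊕∈ (f∈ zero) (sumFin∈ k (λ j → f∈ (suc j)))

  expand₂ : ∀ {S} → IsSubring S → ∀ {A B} → S A → S B → ∀ e →
            Σ (Poly n) λ T → S T ×
              ((A ⊕ B) ^P suc e ≈ A ^P suc e ⊕ con (+ suc e) ⊛ (A ^P e ⊛ B) ⊕ B ⊛ B ⊛ T)
  expand₂ S-sub {A} {B} A∈ B∈ zero = con (+ 0) , con∈ (+ 0) ,
    solve 2 (λ A B → (A :+ B) :* con (+ 1)
                     := A :* con (+ 1) :+ con (+ 1) :* (con (+ 1) :* B) :+ B :* B :* con (+ 0))
            ≈-refl A B
    where open IsSubring S-sub
  expand₂ S-sub {A} {B} A∈ B∈ (suc e) with expand₂ S-sub A∈ B∈ e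
  ... | T , T∈ , IH = E ⊛ A ^P e ⊕ (A ⊕ B) ⊛ T ,
                      ⊕∈ (⊛∈ (con∈ _) (^P∈ e A∈)) (⊛∈ (⊕∈ A∈ B∈) T∈) ,
                      ≈-trans (⊛-cong ≈-refl IH)
                        (≈-trans (step A B E (A ^P e) T)
                          (⊕-cong (⊕-cong ≈-refl (⊛-cong (≈-sym (con-+ (+ 1) E′)) ≈-refl)) ≈-refl))
    where
      open IsSubring S-sub
      E′ : ℤ
      E′ = + suc e
      E : Poly n
      E = con E′
      step : ∀ A B E a T →
        (A ⊕ B) ⊛ (A ⊛ a ⊕ E ⊛ (a ⊛ B) ⊕ B ⊛ B ⊛ T)
          ≈ A ⊛ (A ⊛ a) ⊕ (con (+ 1) ⊕ E) ⊛ ((A ⊛ a) ⊛ B) ⊕ B ⊛ B ⊛ (E ⊛ a ⊕ (A ⊕ B) ⊛ T)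
      step = solve 5 (λ A B E a T →
        (A :+ B) :* (A :* a :+ E :* (a :* B) :+ B :* B :* T)
          := A :* (A :* a) :+ (con (+ 1) :+ E) :* ((A :* a) :* B) :+ B :* B :* (E :* a :+ (A :+ B) :* T))
        ≈-refl

  module Congruence (m : Poly n) where

    infix 4 _≡ₘ_
    _≡ₘ_ : Poly n → Poly n → Set
    x ≡ₘ y = Σ (Poly n) λ e → x ≈ y ⊕ m ⊛ e

    ≈⇒≡ₘ : ∀ {x y} → x ≈ y → x ≡ₘ y
    ≈⇒≡ₘ {y = y} x≈y = con (+ 0) ,
      ≈-trans x≈y (solve 2 (λ y m → y := y :+ m :* con (+ 0)) ≈-refl y m)

    ≡ₘ-sym : ∀ {x y} → x ≡ₘ y → y ≡ₘ x
    ≡ₘ-sym {y = y} (e , x≈) = neg e ,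
      ≈-trans (solve 3 (λ y m e → y := (y :+ m :* e) :+ m :* (:- e)) ≈-refl y m e)
              (⊕-cong (≈-sym x≈) ≈-refl)

    ≡ₘ-trans : ∀ {x y z} → x ≡ₘ y → y ≡ₘ z → x ≡ₘ z
    ≡ₘ-trans {z = z} (e , x≈) (f , y≈) = f ⊕ e ,
      ≈-trans x≈ (≈-trans (⊕-cong y≈ ≈-refl)
        (solve 4 (λ z m e f → (z :+ m :* f) :+ m :* e := z :+ m :* (f :+ e)) ≈-refl z m e f))

    ⊕-≡ₘ : ∀ {x x′ y y′} → x ≡ₘ x′ → y ≡ₘ y′ → x ⊕ y ≡ₘ x′ ⊕ y′
    ⊕-≡ₘ {x′ = x′} {y′ = y′} (e , x≈) (f , y≈) = e ⊕ f ,
      ≈-trans (⊕-cong x≈ y≈)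
        (solve 5 (λ x′ y′ m e f → (x′ :+ m :* e) :+ (y′ :+ m :* f) := (x′ :+ y′) :+ m :* (e :+ f))
          ≈-refl x′ y′ m e f)

    ⊛-≡ₘ : ∀ {x x′ y y′} → x ≡ₘ x′ → y ≡ₘ y′ → x ⊛ y ≡ₘ x′ ⊛ y′
    ⊛-≡ₘ {x′ = x′} {y′ = y′} (e , x≈) (f , y≈) = e ⊛ y′ ⊕ x′ ⊛ f ⊕ m ⊛ (e ⊛ f) ,
      ≈-trans (⊛-cong x≈ y≈)
        (solve 5 (λ x′ y′ m e f → (x′ :+ m :* e) :* (y′ :+ m :* f)
                                  := (x′ :* y′) :+ m :* (e :* y′ :+ x′ :* f :+ m :* (e :* f)))
          ≈-refl x′ y′ m e f)

    multiple≡ₘ0 : ∀ z → m ⊛ z ≡ₘ con (+ 0)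
    multiple≡ₘ0 z = z , ≈-sym (⊕-idˡ _)

    ≡ₘ-setoid : Setoid 0ℓ 0ℓ
    ≡ₘ-setoid = record
      { Carrier = Poly n
      ; _≈_ = _≡ₘ_
      ; isEquivalence = record { refl = ≈⇒≡ₘ ≈-refl ; sym = ≡ₘ-sym ; trans = ≡ₘ-trans } }

module Frobenius (q : ℕ) (p-prime : Prime (suc (suc q))) (n : ℕ) where
  open PolyRing n

  p : ℕ
  p = suc (suc q)

  P : Poly n
  P = con (+ p)

  open Congruence P renaming (_≡ₘ_ to _≡ₚ_)
  open import Relation.Binary.Reasoning.Setoid ≡ₘ-setoid

  open import Algebra.Properties.Semiring.Sum semiring using (sum; sum-init-last)
  open import Algebra.Properties.Semiring.Mult semiring using () renaming (_×_ to _·_)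
  import Algebra.Properties.CommutativeSemiring.Binomial commutativeSemiring as Binomial

  ·≈con : ∀ k (z : Poly n) → k · z ≈ con (+ k) ⊛ z
  ·≈con zero z = solve 1 (λ z → con (+ 0) := con (+ 0) :* z) ≈-refl z
  ·≈con (suc k) z = ≈-trans (⊕-cong ≈-refl (·≈con k z))
    (≈-trans (solve 2 (λ z K → z :+ K :* z := (con (+ 1) :+ K) :* z) ≈-refl z (con (+ k)))
             (⊛-cong (≈-sym (con-+ (+ 1) (+ k))) ≈-refl))

  binomial-middle : ∀ k → 0 < k → k < p → ∀ z → (p C k) · z ≡ₚ con (+ 0)
  binomial-middle k 0<k k<p z with prime∣C p-prime k 0<k k<p
  ... | divides r C≡r*p = begin
    (p C k) · z              ≈⟨ ≈⇒≡ₘ (·≈con (p C k) z) ⟩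
    con (+ (p C k)) ⊛ z      ≈⟨ ≈⇒≡ₘ (⊛-cong C≈r·p ≈-refl) ⟩
    con (+ r) ⊛ P ⊛ z        ≈⟨ ≈⇒≡ₘ (solve 3 (λ R P z → R :* P :* z := P :* (R :* z)) ≈-refl _ P z) ⟩
    P ⊛ (con (+ r) ⊛ z)      ≈⟨ multiple≡ₘ0 _ ⟩
    con (+ 0)                ∎
    where
      C≈r·p : con (+ (p C k)) ≈ con (+ r) ⊛ P
      C≈r·p = ≈-trans (≡⇒≈ (cong (λ c → con (+ c)) C≡r*p)) (con-ℕ* r p)

  freshman : ∀ (a b : Poly n) → (a ⊕ b) ^P p ≡ₚ a ^P p ⊕ b ^P p
  freshman a b = begin
    (a ⊕ b) ^P p
      ≈⟨ ≈⇒≡ₘ expansion ⟩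
    t zero ⊕ (sum (λ j → t (suc (inject₁ j))) ⊕ t (suc (fromℕ (suc q))))
      ≈⟨ ⊕-≡ₘ (≈⇒≡ₘ first) (⊕-≡ₘ (sum≡ₚ0 (suc q) middle) (≈⇒≡ₘ (last _ toℕ-last))) ⟩
    b ^P p ⊕ (con (+ 0) ⊕ a ^P p)
      ≈⟨ ≈⇒≡ₘ (solve 2 (λ x y → y :+ (con (+ 0) :+ x) := x :+ y) ≈-refl (a ^P p) (b ^P p)) ⟩
    a ^P p ⊕ b ^P p ∎
    where
      t : Fin (suc p) → Poly n
      t = Binomial.binomialTerm a b p

      expansion : (a ⊕ b) ^P p ≈ t zero ⊕ (sum (λ j → t (suc (inject₁ j))) ⊕ t (suc (fromℕ (suc q))))
      expansion = ≈-trans (≡⇒≈ (sym (^≡^P (a ⊕ b) p)))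
        (≈-trans (Binomial.theorem p a b) (⊕-cong ≈-refl (sum-init-last (λ j → t (suc j)))))

      first : t zero ≈ b ^P p
      first = ≈-trans (solve 1 (λ x → con (+ 1) :* x :+ con (+ 0) := x) ≈-refl (b ^ᴿ p)) (≡⇒≈ (^≡^P b p))

      last : ∀ k → k ≡ p → (p C k) · (a ^ᴿ k ⊛ b ^ᴿ (p ∸ k)) ≈ a ^P p
      last k refl rewrite nCn≡1 p | ℕP.n∸n≡0 p | ^≡^P a p =
        solve 1 (λ x → x :* con (+ 1) :+ con (+ 0) := x) ≈-refl (a ^P p)

      toℕ-last : toℕ (suc (fromℕ (suc q))) ≡ p
      toℕ-last = cong suc (FinP.toℕ-fromℕ (suc q))

      middle : ∀ (j : Fin (suc q)) → t (suc (inject₁ j)) ≡ₚ con (+ 0)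
      middle j = binomial-middle _ (s≤s z≤n) (s≤s (FinP.inject₁ℕ< j)) _

      sum≡ₚ0 : ∀ k {g : Fin k → Poly n} → (∀ j → g j ≡ₚ con (+ 0)) → sum g ≡ₚ con (+ 0)
      sum≡ₚ0 zero g≡0 = ≈⇒≡ₘ ≈-refl
      sum≡ₚ0 (suc k) g≡0 =
        ≡ₘ-trans (⊕-≡ₘ (g≡0 zero) (sum≡ₚ0 k (λ j → g≡0 (suc j)))) (≈⇒≡ₘ (⊕-idˡ _))

  zero^p : con {n} (+ 0) ^P p ≈ con (+ 0)
  zero^p = solve 1 (λ x → con (+ 0) :* x := con (+ 0)) ≈-refl (con (+ 0) ^P suc q)

  one^P : ∀ e → con {n} (+ 1) ^P e ≈ con (+ 1)
  one^P zero = ≈-refl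
  one^P (suc e) = ≈-trans (⊛-idˡ _) (one^P e)

  fermat-ℕ : ∀ k → con (+ k) ^P p ≡ₚ con (+ k)
  fermat-ℕ zero = ≈⇒≡ₘ zero^p
  fermat-ℕ (suc k) = begin
    con (+ suc k) ^P p                   ≈⟨ ≈⇒≡ₘ (^P-cong p (con-+ (+ 1) (+ k))) ⟩
    (con (+ 1) ⊕ con (+ k)) ^P p         ≈⟨ freshman _ _ ⟩
    con (+ 1) ^P p ⊕ con (+ k) ^P p      ≈⟨ ⊕-≡ₘ (≈⇒≡ₘ (one^P p)) (fermat-ℕ k) ⟩
    con (+ 1) ⊕ con (+ k)                ≈⟨ ≈⇒≡ₘ (≈-sym (con-+ (+ 1) (+ k))) ⟩
    con (+ suc k)                        ∎

  fermat-negation : ∀ {x y} → x ⊕ y ≈ con (+ 0) → y ^P p ≡ₚ y → x ^P p ≡ₚ x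
  fermat-negation {x} {y} x+y≈0 y^p≡y = begin
    x ^P p
      ≈⟨ ≈⇒≡ₘ (cancel (x ^P p) (y ^P p)) ⟩
    (x ^P p ⊕ y ^P p) ⊕ neg (y ^P p)
      ≈⟨ ⊕-≡ₘ (≡ₘ-sym (freshman x y)) (⊛-≡ₘ (≈⇒≡ₘ ≈-refl) y^p≡y) ⟩
    (x ⊕ y) ^P p ⊕ neg y
      ≈⟨ ≈⇒≡ₘ (⊕-cong (≈-trans (^P-cong p x+y≈0) zero^p) ≈-refl) ⟩
    con (+ 0) ⊕ neg y
      ≈⟨ ≈⇒≡ₘ (⊕-cong (≈-sym x+y≈0) ≈-refl) ⟩
    (x ⊕ y) ⊕ neg y
      ≈⟨ ≈⇒≡ₘ (≈-sym (cancel x y)) ⟩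
    x ∎
    where
      cancel : ∀ u v → u ≈ (u ⊕ v) ⊕ neg v
      cancel = solve 2 (λ u v → u := (u :+ v) :+ (:- v)) ≈-refl

  fermat : ∀ c → con c ^P p ≡ₚ con c
  fermat (+ k) = fermat-ℕ k
  fermat -[1+ k ] = fermat-negation -k+k≈0 (fermat-ℕ (suc k))
    where
      -k+k≈0 : con -[1+ k ] ⊕ con (+ suc k) ≈ con (+ 0)
      -k+k≈0 = ≈-trans (≈-sym (con-+ -[1+ k ] (+ suc k))) (≡⇒≈ (cong con (ℤP.+-inverseˡ (+ suc k))))

  frobenius : ∀ (G : Poly n) → G ^P p ≡ₚ σ p G
  frobenius (con c) = fermat c
  frobenius (var i) = ≈⇒≡ₘ ≈-refl
  frobenius (a ⊕ b) = ≡ₘ-trans (freshman a b) (⊕-≡ₘ (frobenius a) (frobenius b))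
  frobenius (a ⊛ b) = ≡ₘ-trans (≈⇒≡ₘ (^P-distrib a b p)) (⊛-≡ₘ (frobenius a) (frobenius b))

module Levels (p n : ℕ) where
  open PolyRing n

  P : Poly n
  P = con (+ p)

  InR : ℕ → Poly n → Set
  InR zero F = ⊤
  InR (suc k) F = Σ (Poly n) λ G → Σ (Poly n) λ H → InR k H × (F ≈ σ (p ^ suc k) G ⊕ P ⊛ H)

  InR-resp : ∀ k {a b} → a ≈ b → InR k a → InR k b
  InR-resp zero a≈b _ = tt
  InR-resp (suc k) a≈b (G , H , H∈ , a≈) = G , H , H∈ , ≈-trans (≈-sym a≈b) a≈

  σ∈ : ∀ k G → InR k (σ (p ^ k) G)
  σ∈ zero G = tt
  σ∈ (suc k) G = G , con (+ 0) , σ∈ k (con (+ 0)) ,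
    solve 2 (λ S P → S := S :+ P :* con (+ 0)) ≈-refl (σ (p ^ suc k) G) P

  con∈ : ∀ k c → InR k (con c)
  con∈ k c = σ∈ k (con c)

  -- R_{k+1} ⊆ R_k on the σ-part: σ_{p^{k+1}}(G) = σ_{p^k}(σ_p G).
  σ-next∈ : ∀ k G → InR k (σ (p ^ suc k) G)
  σ-next∈ k G = InR-resp k (σ-σ (p ^ k) p G) (σ∈ k (σ p G))

  ⊕∈ : ∀ k {a b} → InR k a → InR k b → InR k (a ⊕ b)
  ⊕∈ zero _ _ = tt
  ⊕∈ (suc k) (G , H , H∈ , a≈) (G′ , H′ , H′∈ , b≈) = G ⊕ G′ , H ⊕ H′ , ⊕∈ k H∈ H′∈ ,
    ≈-trans (⊕-cong a≈ b≈)
      (solve 5 (λ A B P H H′ → (A :+ P :* H) :+ (B :+ P :* H′) := (A :+ B) :+ P :* (H :+ H′))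
        ≈-refl _ _ P H H′)

  -- (A + pH)(B + pH′) = AB + p(HB + AH′ + pHH′), with A, B ∈ σ_{p^{k+1}}(Z[X]) ⊆ R_k.
  ⊛∈ : ∀ k {a b} → InR k a → InR k b → InR k (a ⊛ b)
  ⊛∈ zero _ _ = tt
  ⊛∈ (suc k) (G , H , H∈ , a≈) (G′ , H′ , H′∈ , b≈) =
    G ⊛ G′ , H ⊛ B ⊕ A ⊛ H′ ⊕ P ⊛ (H ⊛ H′) ,
    ⊕∈ k (⊕∈ k (⊛∈ k H∈ (σ-next∈ k G′)) (⊛∈ k (σ-next∈ k G) H′∈))
         (⊛∈ k (con∈ k (+ p)) (⊛∈ k H∈ H′∈)) ,
    ≈-trans (⊛-cong a≈ b≈)
      (solve 5 (λ A B P H H′ → (A :+ P :* H) :* (B :+ P :* H′)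
                               := A :* B :+ P :* (H :* B :+ A :* H′ :+ P :* (H :* H′)))
        ≈-refl A B P H H′)
    where
      A B : Poly n
      A = σ (p ^ suc k) G
      B = σ (p ^ suc k) G′

  InR-subring : ∀ k → IsSubring (InR k)
  InR-subring k = record { ∈-resp = InR-resp k ; con∈ = con∈ k ; ⊕∈ = ⊕∈ k ; ⊛∈ = ⊛∈ k }

  p⊛∈ : ∀ k {H} → InR k H → InR (suc k) (P ⊛ H)
  p⊛∈ k {H} H∈ = con (+ 0) , H , H∈ , ≈-sym (⊕-idˡ _)

  p^⊛ : ∀ j (x : Poly n) → P ⊛ (con (+ (p ^ j)) ⊛ x) ≈ con (+ (p ^ suc j)) ⊛ x
  p^⊛ j x = ≈-trans (≈-sym (⊛-assoc P _ x)) (⊛-cong (≈-sym (con-ℕ* p (p ^ j))) ≈-refl)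

  p^⊛∈ : ∀ j m {x} → InR m x → InR (j + m) (con (+ (p ^ j)) ⊛ x)
  p^⊛∈ zero m {x} x∈ = InR-resp m (≈-sym (⊛-idˡ x)) x∈
  p^⊛∈ (suc j) m {x} x∈ = InR-resp (suc (j + m)) (p^⊛ j x) (p⊛∈ (j + m) (p^⊛∈ j m x∈))

  expansion : ∀ k → (Fin (suc k) → Poly n) → Poly n
  expansion k G = sumFin (suc k) (λ j → con (+ (p ^ toℕ j)) ⊛ σ (p ^ (k ∸ toℕ j)) (G j))

  expansion-suc : ∀ k G →
    expansion (suc k) G ≈ σ (p ^ suc k) (G zero) ⊕ P ⊛ expansion k (λ j → G (suc j))
  expansion-suc k G = ⊕-cong (⊛-idˡ _)
    (≈-trans (sumFin-cong (λ j → ≈-sym (p^⊛ (toℕ j) (term j))))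
             (sumFin-factor (suc k) P (λ j → con (+ (p ^ toℕ j)) ⊛ term j)))
    where
      term : Fin (suc k) → Poly n
      term j = σ (p ^ (k ∸ toℕ j)) (G (suc j))

      sumFin-cong : ∀ {m} {f g : Fin m → Poly n} → (∀ j → f j ≈ g j) → sumFin m f ≈ sumFin m g
      sumFin-cong {zero} f≈g = ≈-refl
      sumFin-cong {suc m} f≈g = ⊕-cong (f≈g zero) (sumFin-cong (λ j → f≈g (suc j)))

      sumFin-factor : ∀ m c (f : Fin m → Poly n) → sumFin m (λ j → c ⊛ f j) ≈ c ⊛ sumFin m f
      sumFin-factor zero c f = solve 1 (λ c → con (+ 0) := c :* con (+ 0)) ≈-refl c
      sumFin-factor (suc m) c f =
        ≈-trans (⊕-cong ≈-refl (sumFin-factor m c (λ j → f (suc j)))) (≈-sym (distribˡ _ _ _))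

  inR⇒InR : ∀ k {F} → inR p k F → InR k F
  inR⇒InR zero _ = tt
  inR⇒InR (suc k) (G , F≈) = G zero , expansion k (λ j → G (suc j)) ,
    inR⇒InR k ((λ j → G (suc j)) , ≈-refl) , ≈-trans F≈ (expansion-suc k G)

  InR⇒inR : ∀ k {F} → InR k F → inR p k F
  InR⇒inR zero {F} _ = (λ _ → F) ,
    ≈-trans (solve 1 (λ F → F := con (+ 1) :* F :+ con (+ 0)) ≈-refl F)
            (⊕-cong (⊛-cong ≈-refl (≈-sym (σ-one F))) ≈-refl)
  InR⇒inR (suc k) (G , H , H∈ , F≈) with InR⇒inR k H∈
  ... | Gs , H≈ = G∷Gs ,
    ≈-trans F≈ (≈-trans (⊕-cong ≈-refl (⊛-cong ≈-refl H≈)) (≈-sym (expansion-suc k G∷Gs)))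
    where
      G∷Gs : Fin (suc (suc k)) → Poly n
      G∷Gs zero = G
      G∷Gs (suc j) = Gs j

module PowerLevels (q : ℕ) (p-prime : Prime (suc (suc q))) (n : ℕ) where
  open PolyRing n
  open Frobenius q p-prime n using (p; P; frobenius)
  open Levels p n public hiding (P)
  open import Relation.Binary.Reasoning.Setoid setoid

  σ-frobenius : ∀ e (G : Poly n) → Σ (Poly n) λ c → σ e G ^P p ≈ σ (p * e) G ⊕ P ⊛ σ e c
  σ-frobenius e G with frobenius G
  ... | c , G^p≈ = c ,
    ≈-trans (≡⇒≈ (sym (subst-^P G _ p))) (≈-trans (subst-resp _ G^p≈) (⊕-cong (σ-σ e p G) ≈-refl))

  -- For x = A + pH with A = σ_{p^{k+1}}(G), expand (A + pH)^p to second order: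
  -- A^p gives σ_{p^{k+2}}(G) + p·σ_{p^{k+1}}(c), and the remaining terms are
  -- p·(A^{p-1}·pH) and (pH)²T = p·(p·H²T), all in p·R_{k+1}.
  ^p∈ : ∀ k {x} → InR k x → InR (suc k) (x ^P p)
  ^p∈ zero {x} _ with frobenius x
  ... | c , x^p≈ = x , c , tt ,
    ≈-trans x^p≈ (⊕-cong (≡⇒≈ (cong (λ e → σ e x) (sym (ℕP.*-identityʳ p)))) ≈-refl)
  ^p∈ (suc k) {x} (G , H , H∈ , x≈) = G , rest , rest∈ , x^p≈
    where
      A : Poly n
      A = σ (p ^ suc k) G

      open Σ (expand₂ (InR-subring k) (σ-next∈ k G) (⊛∈ k (con∈ k (+ p)) H∈) (suc q))
        renaming (proj₁ to T; proj₂ to T-facts)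
      T∈ : InR k T
      T∈ = proj₁ T-facts
      binomial : (A ⊕ P ⊛ H) ^P p ≈ A ^P p ⊕ P ⊛ (A ^P suc q ⊛ (P ⊛ H)) ⊕ P ⊛ H ⊛ (P ⊛ H) ⊛ T
      binomial = proj₂ T-facts

      open Σ (σ-frobenius (p ^ suc k) G) renaming (proj₁ to c; proj₂ to A^p≈)

      rest : Poly n
      rest = σ (p ^ suc k) c ⊕ A ^P suc q ⊛ (P ⊛ H) ⊕ P ⊛ (H ⊛ H ⊛ T)
      rest∈ : InR (suc k) rest
      rest∈ = ⊕∈ (suc k)
        (⊕∈ (suc k) (σ∈ (suc k) c) (⊛∈ (suc k) (^P∈ (suc q) (σ∈ (suc k) G)) (p⊛∈ k H∈)))
        (p⊛∈ k (⊛∈ k (⊛∈ k H∈ H∈) T∈))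
        where open IsSubring (InR-subring (suc k)) using (^P∈)
      x^p≈ : x ^P p ≈ σ (p ^ suc (suc k)) G ⊕ P ⊛ rest
      x^p≈ = begin
        x ^P p
          ≈⟨ ^P-cong p x≈ ⟩
        (A ⊕ P ⊛ H) ^P p
          ≈⟨ binomial ⟩
        A ^P p ⊕ P ⊛ (A ^P suc q ⊛ (P ⊛ H)) ⊕ P ⊛ H ⊛ (P ⊛ H) ⊛ T
          ≈⟨ ⊕-cong (⊕-cong A^p≈ ≈-refl) ≈-refl ⟩
        (σ (p ^ suc (suc k)) G ⊕ P ⊛ σ (p ^ suc k) c) ⊕ P ⊛ (A ^P suc q ⊛ (P ⊛ H))
          ⊕ P ⊛ H ⊛ (P ⊛ H) ⊛ T
          ≈⟨ solve 6 (λ S C a P H T →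
               (S :+ P :* C) :+ P :* (a :* (P :* H)) :+ P :* H :* (P :* H) :* T
                 := S :+ P :* (C :+ a :* (P :* H) :+ P :* (H :* H :* T)))
               ≈-refl _ _ _ P H T ⟩
        σ (p ^ suc (suc k)) G ⊕ P ⊛ rest ∎

  ^p^d∈ : ∀ d {ℓ x} → InR ℓ x → InR (d + ℓ) (x ^P (p ^ d))
  ^p^d∈ zero {ℓ} {x} x∈ = InR-resp ℓ (≈-sym (^P-one x)) x∈
  ^p^d∈ (suc d) {ℓ} {x} x∈ = InR-resp (suc (d + ℓ)) (^P-^P x (p ^ d) p) (^p∈ (d + ℓ) (^p^d∈ d x∈))

  -- The main computation: if ψ_i ∈ R_ℓ then
  -- Σ_j p^j G_j(ψ^{p^{k-j}}) ∈ R_{k+ℓ}, since its j-th term lies in R_{j+((k-j)+ℓ)}.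
  substituted-expansion∈ : ∀ k ℓ G (ψ : Fin n → Poly n) → (∀ i → InR ℓ (ψ i)) →
                           InR (k + ℓ) (subst (expansion k G) ψ)
  substituted-expansion∈ k ℓ G ψ ψ∈ =
    InR-resp (k + ℓ) (≡⇒≈ (sym (subst-sumFin (suc k) term ψ))) (sumFin∈ (suc k) term∈)
    where
      open IsSubring (InR-subring (k + ℓ)) using (sumFin∈)
      term : Fin (suc k) → Poly n
      term j = con (+ (p ^ toℕ j)) ⊛ σ (p ^ (k ∸ toℕ j)) (G j)
      level : ∀ j → j ≤ k → j + ((k ∸ j) + ℓ) ≡ k + ℓ
      level j j≤k = trans (sym (ℕP.+-assoc j (k ∸ j) ℓ)) (cong (_+ ℓ) (ℕP.m+[n∸m]≡n j≤k))
      term∈ : ∀ j → InR (k + ℓ) (subst (term j) ψ)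
      term∈ j = ≡-subst (λ m → InR m (subst (term j) ψ)) (level (toℕ j) (FinP.toℕ≤pred[n] j))
        (p^⊛∈ (toℕ j) ((k ∸ toℕ j) + ℓ)
          (InR-resp _ (≈-sym (subst-σ (p ^ (k ∸ toℕ j)) (G j) ψ))
            (subst∈ (λ i → ^p^d∈ (k ∸ toℕ j) (ψ∈ i)) (G j))))
        where open IsSubring (InR-subring ((k ∸ toℕ j) + ℓ)) using (subst∈)

lemma3p2 : (p : ℕ) → Prime p → (n : ℕ) → 1 ≤ n → (k ℓ : ℕ) → (F : Poly n) → inR p k F →
    (ψ : Fin n → Poly n) → ((i : Fin n) → inR p ℓ (ψ i)) → inR p (k + ℓ) (subst F ψ)
lemma3p2 zero p-prime with prime⇒nonTrivial p-prime
... | ()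
lemma3p2 (suc zero) p-prime with prime⇒nonTrivial p-prime
... | ()
lemma3p2 (suc (suc q)) p-prime n _ k ℓ F (G , F≈expansion) ψ ψ∈ =
  InR⇒inR (k + ℓ)
    (InR-resp (k + ℓ) (≈-sym (subst-resp ψ F≈expansion))
      (substituted-expansion∈ k ℓ G ψ (λ i → inR⇒InR ℓ (ψ∈ i))))
  where open PowerLevels q p-prime n
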